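{- Let $G=(V,E)$ be a finite graph and let $\gamma(G)$ denote its domination number. Then the vertex set $V$ can be partitioned into $\gamma(G)$ pairwise disjoint vertex subsets $S_1, S_2, \ldots, S_{\gamma(G)}$ such that each $S_i$ ($1 \leq i \leq \gamma(G)$) contains a vertex from a minimum dominating set in $G$ and is not outer-dominated.
   Context: A set $D \subseteq V$ is a dominating set of $G$ if every vertex of $V \setminus D$ is adjacent to at least one vertex of $D$; a minimum dominating set is a dominating set of smallest cardinality, and the domination number $\gamma(G)$ is that smallest cardinality. A vertex subset $S \subseteq V$ is called outer-dominated if there exists a vertex $u \notin S$ such that $u$ is adjacent to every vertex of $S$. -}

module Defs where

open import Data.Nat using (ℕ; _≤_)
open import Data.Fin using (Fin)
open import Data.Fin.Subset using (Subset; _∈_; _∉_; ∣_∣)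
open import Data.Product using (Σ; ∃; _×_; _,_)
open import Data.Sum using (_⊎_)
open import Relation.Nullary using (¬_; Dec)
open import Relation.Binary.PropositionalEquality using (_≡_)
open import Level using (0ℓ) renaming (suc to lsuc)

record Graph (n : ℕ) : Set₁ where
  field
    Adj    : Fin n → Fin n → Set
    adj?   : ∀ u v → Dec (Adj u v)
    sym    : ∀ {u v} → Adj u v → Adj v u
    irrefl : ∀ {u} → ¬ Adj u u
open Graph public

IsDominatingSet : ∀ {n} → Graph n → Subset n → Set
IsDominatingSet G D = ∀ v → v ∉ D → ∃ λ u → u ∈ D × Adj G u v

IsMinDomSet : ∀ {n} → Graph n → Subset n → Set
IsMinDomSet G D =
  IsDominatingSet G D × (∀ D′ → IsDominatingSet G D′ → ∣ D ∣ ≤ ∣ D′ ∣)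

IsDominationNumber : ∀ {n} → Graph n → ℕ → Set
IsDominationNumber G k = ∃ λ D → IsMinDomSet G D × ∣ D ∣ ≡ k

OuterDominated : ∀ {n} → Graph n → (Fin n → Set) → Set
OuterDominated G S = ∃ λ u → ¬ S u × (∀ v → S v → Adj G u v)

module Submission where

-- Fix a minimum dominating set D = {c₀, …, c_{γ-1}} (the
-- "centres").  A centred partition assigns every vertex v a part p(v) such
-- that each centre lies in its own part and every vertex equals or is
-- adjacent to the centre of its part; D being dominating gives one.  Count
-- the conflicts of p: ordered pairs (v, w) in the same part with v, w not
-- adjacent.  If some part S_i is outer-dominated by a vertex u ∉ S_i, look at
-- the part S_j of u:
--   * if u is adjacent to every other vertex of S_j, then replacing c_j by u
--     and dropping c_i leaves γ - 1 vertices dominating G — impossible;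
--   * otherwise some x ∈ S_j is neither u nor adjacent to u; then u is no
--     centre, and moving u into S_i keeps the partition centred, creates no
--     conflict (u is adjacent to all of S_i) and removes the conflict (u, x).
-- Hence by well-founded descent on the number of conflicts we reach a
-- centred partition with no outer-dominated part; its parts contain the
-- centres c_i ∈ D, which is the theorem.

open import Defs
open import Data.Nat using (ℕ; zero; suc; _*_; _≤_; _<_; s≤s)
open import Data.Nat.Properties using (≤-reflexive; ≤-trans; n≤1+n; <⇒≱)
open import Data.Nat.Induction using (<-wellFounded)
open import Induction.WellFounded using (Acc; acc)
open import Data.Fin using (Fin; zero; suc; _≟_; punchIn; punchOut; remQuot; combine)
open import Data.Fin.Properties using (any?; all?; punchIn-punchOut; remQuot-combine)
open import Data.Fin.Subset using (Subset; _∈_; ∣_∣; _∪_; ⁅_⁆; ⊥; inside; outside)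
open import Data.Fin.Subset.Properties
  using (_∈?_; x∈⁅x⁆; x∈p∪q⁺; ∪-identityʳ; ∣⊥∣≡0; p⊂q⇒∣p∣<∣q∣)
open import Data.Vec using (_∷_; tabulate; here; there)
open import Data.Vec.Properties using (lookup∘tabulate; []=⇒lookup; lookup⇒[]=)
open import Data.Vec.Functional using (updateAt)
open import Data.Vec.Functional.Properties using (updateAt-updates; updateAt-minimal)
open import Data.Product using (∃; _×_; _,_; proj₁; proj₂)
open import Data.Sum using (_⊎_; inj₁; inj₂)
open import Data.Empty using () renaming (⊥ to Empty; ⊥-elim to ⊥-elim)
open import Function using (_∘_; const)
open import Relation.Nullary using (¬_; Dec; yes; no; does)
open import Relation.Nullary.Decidable using (_×-dec_; _→-dec_; ¬?; dec-true)
open import Relation.Binary.PropositionalEquality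
  using (_≡_; _≢_; refl; cong; subst; trans; module ≡-Reasoning)
  renaming (sym to ≡-sym)

enum : ∀ {n} (p : Subset n) → Fin ∣ p ∣ → Fin n
enum (inside  ∷ p) zero    = zero
enum (inside  ∷ p) (suc i) = suc (enum p i)
enum (outside ∷ p) i       = suc (enum p i)

enum-∈ : ∀ {n} (p : Subset n) i → enum p i ∈ p
enum-∈ (inside  ∷ p) zero    = here
enum-∈ (inside  ∷ p) (suc i) = there (enum-∈ p i)
enum-∈ (outside ∷ p) i       = there (enum-∈ p i)

idx : ∀ {n} (p : Subset n) {v} → v ∈ p → Fin ∣ p ∣
idx (inside  ∷ p) here      = zero
idx (inside  ∷ p) (there h) = suc (idx p h)
idx (outside ∷ p) (there h) = idx p h

enum-idx : ∀ {n} (p : Subset n) {v} (h : v ∈ p) → enum p (idx p h) ≡ v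
enum-idx (inside  ∷ p) here      = refl
enum-idx (inside  ∷ p) (there h) = cong suc (enum-idx p h)
enum-idx (outside ∷ p) (there h) = cong suc (enum-idx p h)

idx-enum : ∀ {n} (p : Subset n) i (h : enum p i ∈ p) → idx p h ≡ i
idx-enum (inside  ∷ p) zero    here      = refl
idx-enum (inside  ∷ p) (suc i) (there h) = cong suc (idx-enum p i h)
idx-enum (outside ∷ p) i       (there h) = idx-enum p i h

select : ∀ {m} {P : Fin m → Set} → (∀ x → Dec (P x)) → Subset m
select P? = tabulate (does ∘ P?)

∈-select⁺ : ∀ {m} {P : Fin m → Set} (P? : ∀ x → Dec (P x)) {x} → P x → x ∈ select P?
∈-select⁺ P? {x} px = lookup⇒[]= x (select P?) (trans (lookup∘tabulate (does ∘ P?) x) (dec-true (P? x) px))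

∈-select⁻ : ∀ {m} {P : Fin m → Set} (P? : ∀ x → Dec (P x)) {x} → x ∈ select P? → P x
∈-select⁻ P? {x} x∈ with P? x | trans (≡-sym (lookup∘tabulate (does ∘ P?) x)) ([]=⇒lookup x∈)
... | yes px | _ = px
... | no  _  | ()

select-< : ∀ {m} {P Q : Fin m → Set} (P? : ∀ x → Dec (P x)) (Q? : ∀ x → Dec (Q x)) →
  (∀ x → P x → Q x) → ∀ y → Q y → ¬ P y → ∣ select P? ∣ < ∣ select Q? ∣
select-< P? Q? P⇒Q y qy ¬py = p⊂q⇒∣p∣<∣q∣
  ( (λ {x} x∈ → ∈-select⁺ Q? (P⇒Q x (∈-select⁻ P? x∈)))
  , y , ∈-select⁺ Q? qy , ¬py ∘ ∈-select⁻ P? )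

PairAt : ∀ {n} → (Fin n → Fin n → Set) → Fin (n * n) → Set
PairAt {n} R k = R (proj₁ (remQuot {n} n k)) (proj₂ (remQuot {n} n k))

pairAt? : ∀ {n} {R : Fin n → Fin n → Set} → (∀ v w → Dec (R v w)) → ∀ k → Dec (PairAt R k)
pairAt? {n} R? k = R? (proj₁ (remQuot {n} n k)) (proj₂ (remQuot {n} n k))

countPairs : ∀ {n} {R : Fin n → Fin n → Set} → (∀ v w → Dec (R v w)) → ℕ
countPairs R? = ∣ select (pairAt? R?) ∣

PairAt-combine : ∀ {n} (R : Fin n → Fin n → Set) {a b} → R a b → PairAt R (combine a b)
PairAt-combine {n} R {a} {b} rab =
  subst (λ q → R (proj₁ q) (proj₂ q)) (≡-sym (remQuot-combine {n} {n} a b)) rab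

PairAt-split : ∀ {n} (R : Fin n → Fin n → Set) {a b} → PairAt R (combine a b) → R a b
PairAt-split {n} R {a} {b} r =
  subst (λ q → R (proj₁ q) (proj₂ q)) (remQuot-combine {n} {n} a b) r

countPairs-< : ∀ {n} {R S : Fin n → Fin n → Set}
  (R? : ∀ v w → Dec (R v w)) (S? : ∀ v w → Dec (S v w)) →
  (∀ v w → R v w → S v w) → ∀ {a b} → S a b → ¬ R a b → countPairs R? < countPairs S?
countPairs-< {R = R} {S} R? S? R⇒S {a} {b} sab ¬rab =
  select-< (pairAt? R?) (pairAt? S?) (λ k → R⇒S _ _) (combine a b) (PairAt-combine S sab) (¬rab ∘ PairAt-split R)

img : ∀ {m n} → (Fin m → Fin n) → Subset n
img {zero}  f = ⊥
img {suc m} f = img (f ∘ suc) ∪ ⁅ f zero ⁆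

∣p∪⁅y⁆∣≤1+∣p∣ : ∀ {n} (p : Subset n) y → ∣ p ∪ ⁅ y ⁆ ∣ ≤ suc ∣ p ∣
∣p∪⁅y⁆∣≤1+∣p∣ (outside ∷ p) zero    = s≤s (≤-reflexive (cong ∣_∣ (∪-identityʳ p)))
∣p∪⁅y⁆∣≤1+∣p∣ (inside  ∷ p) zero    = s≤s (≤-trans (≤-reflexive (cong ∣_∣ (∪-identityʳ p))) (n≤1+n _))
∣p∪⁅y⁆∣≤1+∣p∣ (outside ∷ p) (suc y) = ∣p∪⁅y⁆∣≤1+∣p∣ p y
∣p∪⁅y⁆∣≤1+∣p∣ (inside  ∷ p) (suc y) = s≤s (∣p∪⁅y⁆∣≤1+∣p∣ p y)

∣img∣≤ : ∀ {m n} (f : Fin m → Fin n) → ∣ img f ∣ ≤ m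
∣img∣≤ {zero}  {n} f = ≤-reflexive (∣⊥∣≡0 n)
∣img∣≤ {suc m}     f = ≤-trans (∣p∪⁅y⁆∣≤1+∣p∣ (img (f ∘ suc)) (f zero)) (s≤s (∣img∣≤ (f ∘ suc)))

img-∈ : ∀ {m n} (f : Fin m → Fin n) k → f k ∈ img f
img-∈ f zero    = x∈p∪q⁺ (inj₂ (x∈⁅x⁆ (f zero)))
img-∈ f (suc k) = x∈p∪q⁺ (inj₁ (img-∈ (f ∘ suc) k))

outerDominated? : ∀ {n} (G : Graph n) {S : Fin n → Set} → (∀ v → Dec (S v)) → Dec (OuterDominated G S)
outerDominated? G S? = any? (λ u → ¬? (S? u) ×-dec all? (λ v → S? v →-dec adj? G u v))

Near : ∀ {n} → Graph n → Fin n → Fin n → Set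
Near G c v = v ≡ c ⊎ Adj G c v

DominatingFamily : ∀ {m n} → Graph n → (Fin m → Fin n) → Set
DominatingFamily G f = ∀ v → ∃ λ k → Near G (f k) v

img-dominating : ∀ {m n} (G : Graph n) (f : Fin m → Fin n) → DominatingFamily G f → IsDominatingSet G (img f)
img-dominating G f cover v v∉ with cover v
... | k , inj₁ refl = ⊥-elim (v∉ (img-∈ f k))
... | k , inj₂ adj  = f k , img-∈ f k , adj

avoidable-index : ∀ {n γ} (G : Graph n) (f : Fin γ → Fin n) (i : Fin γ) →
  (∀ v → ∃ λ k → k ≢ i × Near G (f k) v) → ∃ λ D → IsDominatingSet G D × ∣ D ∣ < γ
avoidable-index {n} {suc m} G f i cover = img g , img-dominating G g cover′ , s≤s (∣img∣≤ g)
  where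
  g : Fin m → Fin n
  g = f ∘ punchIn i
  cover′ : DominatingFamily G g
  cover′ v with cover v
  ... | k , k≢i , near = punchOut (k≢i ∘ ≡-sym) ,
    subst (λ c → Near G c v) (≡-sym (cong f (punchIn-punchOut (k≢i ∘ ≡-sym)))) near

module Centred {n} (G : Graph n) {γ} (centre : Fin γ → Fin n) where

  record Assignment : Set where
    field
      part        : Fin n → Fin γ
      centre-part : ∀ i → part (centre i) ≡ i
      near-centre : ∀ v → Near G (centre (part v)) v

  Conflict : (Fin n → Fin γ) → Fin n → Fin n → Set
  Conflict p v w = p v ≡ p w × ¬ Adj G v w

  conflict? : (p : Fin n → Fin γ) → ∀ v w → Dec (Conflict p v w)
  conflict? p v w = (p v ≟ p w) ×-dec ¬? (adj? G v w)

  conflicts : (Fin n → Fin γ) → ℕ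
  conflicts p = countPairs (conflict? p)

initial : ∀ {n} (G : Graph n) (D : Subset n) → IsDominatingSet G D → Centred.Assignment G (enum D)
initial {n} G D dom = record { part = part ; centre-part = centre-part ; near-centre = near-centre }
  where
  dominator : ∀ v → ∃ λ c → c ∈ D × Near G c v
  dominator v with v ∈? D
  ... | yes v∈D = v , v∈D , inj₁ refl
  ... | no  v∉D with dom v v∉D
  ...   | c , c∈D , adj = c , c∈D , inj₂ adj

  part : Fin n → Fin ∣ D ∣
  part v = idx D (proj₁ (proj₂ (dominator v)))

  centre-part : ∀ i → part (enum D i) ≡ i
  centre-part i with enum D i ∈? D
  ... | yes c∈D = idx-enum D i c∈D
  ... | no  c∉D = ⊥-elim (c∉D (enum-∈ D i))

  near-centre : ∀ v → Near G (enum D (part v)) v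
  near-centre v with dominator v
  ... | c , c∈D , near = subst (λ c′ → Near G c′ v) (≡-sym (enum-idx D c∈D)) near

module Descent {n} (G : Graph n) {γ} (centre : Fin γ → Fin n)
               (minimal : ∀ D → IsDominatingSet G D → γ ≤ ∣ D ∣) where

  open Centred G centre

  Settled : Assignment → Set
  Settled a = ∀ i → ¬ OuterDominated G (λ v → Assignment.part a v ≡ i)

  module Step (a : Assignment) (i : Fin γ) (u : Fin n)
              (u∉i : Assignment.part a u ≢ i)
              (u-dom : ∀ v → Assignment.part a v ≡ i → Adj G u v) where

    open Assignment a

    j : Fin γ
    j = part u

    -- If u is near every vertex of part j, then the centres with c_j replaced
    -- by u cover G without c_i, contradicting minimality.
    centre′ : Fin γ → Fin n
    centre′ = updateAt centre j (const u)

    cover : (∀ v → part v ≡ j → Near G u v) → ∀ v → ∃ λ k → k ≢ i × Near G (centre′ k) v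
    cover u-near v with part v ≟ i | part v ≟ j
    ... | yes v∈i | _       = j , u∉i , subst (λ c → Near G c v) (≡-sym (updateAt-updates j centre)) (inj₂ (u-dom v v∈i))
    ... | no  _   | yes v∈j = j , u∉i , subst (λ c → Near G c v) (≡-sym (updateAt-updates j centre)) (u-near v v∈j)
    ... | no  v∉i | no  v∉j = part v , v∉i ,
      subst (λ c → Near G c v) (≡-sym (updateAt-minimal (part v) j centre v∉j)) (near-centre v)

    no-collapse : (∀ v → part v ≡ j → Near G u v) → Empty
    no-collapse u-near with avoidable-index G centre′ i (cover u-near)
    ... | D , D-dom , smaller = <⇒≱ smaller (minimal D D-dom)

    -- Otherwise some x in part j is neither u nor adjacent to u; moving u
    -- into part i keeps the partition centred and removes the conflict (u, x).
    module Move (x : Fin n) (x∈j : part x ≡ j) (x≢u : x ≢ u) (u≁x : ¬ Adj G u x) where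

      part′ : Fin n → Fin γ
      part′ = updateAt part u (const i)

      part′-u : part′ u ≡ i
      part′-u = updateAt-updates u part

      part′-other : ∀ {v} → v ≢ u → part′ v ≡ part v
      part′-other {v} v≢u = updateAt-minimal v u part v≢u

      -- u is no centre: the centre of u's part would then be u, yet it is
      -- near x.
      u-not-centre : ∀ k → centre k ≢ u
      u-not-centre k cₖ≡u = x-far (subst (λ c → Near G c x) centreₓ≡u (near-centre x))
        where
        open ≡-Reasoning
        x-far : ¬ Near G u x
        x-far (inj₁ x≡u) = x≢u x≡u
        x-far (inj₂ adj) = u≁x adj
        centreₓ≡u : centre (part x) ≡ u
        centreₓ≡u = begin
          centre (part x)          ≡⟨ cong centre x∈j ⟩
          centre (part u)          ≡⟨ cong (centre ∘ part) (≡-sym cₖ≡u) ⟩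
          centre (part (centre k)) ≡⟨ cong centre (centre-part k) ⟩
          centre k                 ≡⟨ cₖ≡u ⟩
          u                        ∎

      -- u is adjacent to the centre of part i, since it dominates that part.
      near-centre′ : ∀ v → Near G (centre (part′ v)) v
      near-centre′ v with v ≟ u
      ... | yes refl = inj₂ (subst (λ k → Adj G (centre k) u) (≡-sym part′-u)
                              (sym G (u-dom (centre i) (centre-part i))))
      ... | no  v≢u  = subst (λ k → Near G (centre k) v) (≡-sym (part′-other v≢u)) (near-centre v)

      moved : Assignment
      moved = record
        { part        = part′
        ; centre-part = λ k → trans (part′-other (u-not-centre k)) (centre-part k)
        ; near-centre = near-centre′
        }

      -- Every conflict after the move was one before: u is adjacent to all
      -- of its new part.
      conflict-kept : ∀ v w → Conflict part′ v w → Conflict part v w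
      conflict-kept v w (same , v≁w) with v ≟ u | w ≟ u
      ... | yes refl | yes refl = refl , v≁w
      ... | yes refl | no  w≢u  =
        ⊥-elim (v≁w (u-dom w (trans (≡-sym (part′-other w≢u)) (trans (≡-sym same) part′-u))))
      ... | no  v≢u  | yes refl =
        ⊥-elim (v≁w (sym G (u-dom v (trans (≡-sym (part′-other v≢u)) (trans same part′-u)))))
      ... | no  v≢u  | no  w≢u  = trans (≡-sym (part′-other v≢u)) (trans same (part′-other w≢u)) , v≁w

      conflict-resolved : ¬ Conflict part′ u x
      conflict-resolved (same , _) =
        u∉i (trans (≡-sym x∈j) (trans (≡-sym (part′-other x≢u)) (trans (≡-sym same) part′-u)))

      fewer-conflicts : conflicts part′ < conflicts part
      fewer-conflicts = countPairs-< (conflict? part′) (conflict? part) conflict-kept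
                          (≡-sym x∈j , u≁x) conflict-resolved

    improve : ∃ λ a′ → conflicts (Assignment.part a′) < conflicts part
    improve with any? (λ x → (part x ≟ j) ×-dec (¬? (x ≟ u) ×-dec ¬? (adj? G u x)))
    ... | yes (x , x∈j , x≢u , u≁x) = Move.moved x x∈j x≢u u≁x , Move.fewer-conflicts x x∈j x≢u u≁x
    ... | no  none                    = ⊥-elim (no-collapse u-near)
      where
      u-near : ∀ v → part v ≡ j → Near G u v
      u-near v v∈j with v ≟ u | adj? G u v
      ... | yes v≡u | _       = inj₁ v≡u
      ... | no  _   | yes adj = inj₂ adj
      ... | no  v≢u | no  u≁v = ⊥-elim (none (v , v∈j , v≢u , u≁v))

  step : (a : Assignment) → Settled a ⊎ ∃ λ a′ → conflicts (Assignment.part a′) < conflicts (Assignment.part a)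
  step a with any? (λ i → outerDominated? G (λ v → Assignment.part a v ≟ i))
  ... | no  none                    = inj₁ (λ i od → none (i , od))
  ... | yes (i , u , u∉i , u-dom) = inj₂ (Step.improve a i u u∉i u-dom)

  settle : (a : Assignment) → Acc _<_ (conflicts (Assignment.part a)) → ∃ Settled
  settle a (acc smaller) with step a
  ... | inj₁ settled        = a , settled
  ... | inj₂ (a′ , fewer) = settle a′ (smaller fewer)

theorem1 : ∀ {n} (G : Graph n) (γ : ℕ) → IsDominationNumber G γ →
    ∃ λ (D : Subset n) → IsMinDomSet G D ×
      (∃ λ (part : Fin n → Fin γ) →
        ∀ (i : Fin γ) →
          (∃ λ v → v ∈ D × part v ≡ i) ×
          ¬ OuterDominated G (λ v → part v ≡ i))
theorem1 G .(∣ D ∣) (D , (D-dom , D-min) , refl) =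
  D , (D-dom , D-min) , part , λ i → (enum D i , enum-∈ D i , centre-part i) , proj₂ result i
  where
  open Descent G (enum D) D-min
  result : ∃ Settled
  result = settle (initial G D D-dom) (<-wellFounded _)
  open Centred.Assignment (proj₁ result)
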